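{- Let $m\ge 2$ and $b$ be integers with $b^2\equiv \pm 1\pmod m$ and $2\le 2b\le m$, and let $r\in\{1,m-1\}$ be odd. Then the rose window graph $R_{2m}(2b,r)$ is a Cayley graph.
   Context: For integers $n\ge 3$ and $1\le a,r\le n-1$, the rose window graph $R_n(a,r)$ has vertex set $\{A_i,B_i : i\in\mathbb{Z}_n\}$ and edges $A_iA_{i+1}$, $A_iB_i$, $A_{i+a}B_i$ and $B_iB_{i+r}$, indices taken modulo $n$. A graph is Cayley iff its automorphism group has a subgroup acting regularly on its vertices. -}

module Defs where

open import Data.Nat using (ℕ; _*_; _+_; _∸_; _≤_; _%_)
open import Data.Nat.Divisibility using () renaming (_∣_ to _∣ℕ_)
open import Data.Fin using (Fin; toℕ)
open import Data.Integer as ℤ using (ℤ; +_)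
open import Data.Integer.Divisibility using (_∣_)
open import Data.Product using (Σ; _×_; _,_)
open import Data.Sum using (_⊎_)
open import Relation.Binary.PropositionalEquality using (_≡_)
open import Function using (_∘_; id)

_≡_[mod_] : ℕ → ℕ → ℕ → Set
x ≡ y [mod n ] = (+ n) ∣ ((+ x) ℤ.- (+ y))

data Vertex (n : ℕ) : Set where
  A : Fin n → Vertex n
  B : Fin n → Vertex n

data Edge (n a r : ℕ) : Vertex n → Vertex n → Set where
  rim   : ∀ i j → toℕ j ≡ toℕ i + 1 [mod n ] → Edge n a r (A i) (A j)
  spoke : ∀ i j → toℕ j ≡ toℕ i [mod n ] → Edge n a r (A j) (B i)
  hub   : ∀ i j → toℕ j ≡ toℕ i + a [mod n ] → Edge n a r (A j) (B i)
  inner : ∀ i j → toℕ j ≡ toℕ i + r [mod n ] → Edge n a r (B i) (B j)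

Adj : (n a r : ℕ) → Vertex n → Vertex n → Set
Adj n a r u v = Edge n a r u v ⊎ Edge n a r v u

_⇔_ : Set → Set → Set
P ⇔ Q = (P → Q) × (Q → P)

_≗_ : {X : Set} → (X → X) → (X → X) → Set
f ≗ g = ∀ x → f x ≡ g x

record Automorphism (V : Set) (E : V → V → Set) : Set where
  field
    to       : V → V
    from     : V → V
    from-to  : ∀ x → from (to x) ≡ x
    to-from  : ∀ x → to (from x) ≡ x
    preserve : ∀ u v → E u v ⇔ E (to u) (to v)
open Automorphism public

-- H is a subgroup of Aut(V,E) acting regularly on V
-- (subgroups given as predicates; group operations are composition of maps,
--  and equality of automorphisms is pointwise equality of the underlying maps)
record RegularSubgroup (V : Set) (E : V → V → Set)
                       (H : Automorphism V E → Set) : Set where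
  field
    has-id  : Σ (Automorphism V E) (λ ρ → H ρ × (to ρ ≗ id))
    has-comp : ∀ σ τ → H σ → H τ →
               Σ (Automorphism V E) (λ ρ → H ρ × (to ρ ≗ (to σ ∘ to τ)))
    has-inv : ∀ σ → H σ →
              Σ (Automorphism V E) (λ ρ → H ρ × ((to ρ ∘ to σ) ≗ id))
    transitive : ∀ u v → Σ (Automorphism V E) (λ σ → H σ × (to σ u ≡ v))
    semiregular : ∀ σ τ → H σ → H τ → ∀ u → to σ u ≡ to τ u → to σ ≗ to τ

-- a graph is Cayley iff Aut has a subgroup acting regularly on vertices
IsCayley : (V : Set) → (V → V → Set) → Set₁
IsCayley V E = Σ (Automorphism V E → Set) (RegularSubgroup V E)

RoseWindowCayley : (n a r : ℕ) → Set₁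
RoseWindowCayley n a r = IsCayley (Vertex n) (Adj n a r)

-- For c ∈ ℤ with c² ≡ 1, c·a ≡ −a and c ≡ ±r (mod n), the maps
-- A_i ↦ A_{i+k}, B_i ↦ B_{i+k} and A_i ↦ B_{ci+k}, B_i ↦ A_{ci+k} (k ∈ ℤ_n)
-- are automorphisms of R_n(a,r); they form a group of order 2n acting
-- regularly on the 2n vertices. For r = 1 take c = −1. For r = m − 1 odd,
-- m is even and c = r works in R_{2m}(2b,r): r² − 1 = m(m − 2) and
-- c·2b + 2b = 2bm are both divisible by 2m.
module Submission where

open import Data.Nat as ℕ using (ℕ; NonZero; suc; s≤s)
import Data.Nat.Properties as ℕ
import Data.Nat.Divisibility as ℕ
open import Data.Nat.Divisibility using (_∣_)
open import Data.Nat.DivMod using (_%_; _/_; m≡m%n+[m/n]*n; [m+kn]%n≡m%n; m<n⇒m%n≡m)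
open import Data.Nat.Tactic.RingSolver as ℕ-Solver using ()
open import Data.Integer as ℤ using (ℤ; +_; -_; _-_; 0ℤ; 1ℤ; -1ℤ)
import Data.Integer.Properties as ℤ
open import Data.Integer.Divisibility.Signed as Signed
  using (divides; ∣ᵤ⇒∣; ∣⇒∣ᵤ; ∣m∣n⇒∣m+n; ∣n⇒∣m*n)
open import Data.Integer.DivMod using (_%ℕ_; _/ℕ_; n%ℕd<d; a≡a%ℕn+[a/ℕn]*n)
open import Data.Integer.Tactic.RingSolver using (solve-∀)
open import Data.Fin as Fin using (Fin; toℕ; fromℕ<)
import Data.Fin.Properties as Fin
open import Data.Product using (Σ; _,_)
open import Data.Sum using (_⊎_; inj₁; inj₂; [_,_]′)
open import Function using (_∘_)
open import Level using (0ℓ)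
open import Relation.Binary.Bundles using (Setoid)
import Relation.Binary.Reasoning.Setoid as SetoidReasoning
open import Relation.Binary.PropositionalEquality
  using (_≡_; refl; sym; trans; cong; cong₂; subst; subst₂; module ≡-Reasoning)
open import Defs

module Congruence (n : ℕ) .{{_ : NonZero n}} where
  open import Data.Integer using (_+_; _*_)

  infix 4 _≈_ _≈±_

  record _≈_ (x y : ℤ) : Set where
    constructor mk≈
    field divides-difference : + n Signed.∣ x - y
  open _≈_

  ≈-by : ∀ {x y p q} (s : ℤ) → p ≈ q → x - y ≡ s * (p - q) → x ≈ y
  ≈-by s p≈q eq = mk≈ (subst (+ n Signed.∣_) (sym eq) (∣n⇒∣m*n s (divides-difference p≈q)))

  ≈-by₂ : ∀ {x y p q p′ q′} (s t : ℤ) → p ≈ q → p′ ≈ q′ →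
          x - y ≡ s * (p - q) + t * (p′ - q′) → x ≈ y
  ≈-by₂ s t p≈q p′≈q′ eq = mk≈ (subst (+ n Signed.∣_) (sym eq)
    (∣m∣n⇒∣m+n (∣n⇒∣m*n s (divides-difference p≈q))
               (∣n⇒∣m*n t (divides-difference p′≈q′))))

  ≈-reflexive : ∀ {x y} → x ≡ y → x ≈ y
  ≈-reflexive {x} refl = mk≈ (divides 0ℤ (ℤ.+-inverseʳ x))

  ≈-refl : ∀ {x} → x ≈ x
  ≈-refl = ≈-reflexive refl

  ≈-sym : ∀ {x y} → x ≈ y → y ≈ x
  ≈-sym {x} {y} x≈y = ≈-by -1ℤ x≈y (identity x y)
    where
    identity : ∀ x y → y - x ≡ -1ℤ * (x - y)
    identity = solve-∀

  ≈-trans : ∀ {x y z} → x ≈ y → y ≈ z → x ≈ z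
  ≈-trans {x} {y} {z} x≈y y≈z = ≈-by₂ 1ℤ 1ℤ x≈y y≈z (identity x y z)
    where
    identity : ∀ x y z → x - z ≡ 1ℤ * (x - y) + 1ℤ * (y - z)
    identity = solve-∀

  ≈-setoid : Setoid 0ℓ 0ℓ
  ≈-setoid = record
    { Carrier = ℤ ; _≈_ = _≈_
    ; isEquivalence = record { refl = ≈-refl ; sym = ≈-sym ; trans = ≈-trans } }

  module ≈-Reasoning = SetoidReasoning ≈-setoid

  +-cong : ∀ {x y u v} → x ≈ y → u ≈ v → x + u ≈ y + v
  +-cong {x} {y} {u} {v} x≈y u≈v = ≈-by₂ 1ℤ 1ℤ x≈y u≈v (identity x y u v)
    where
    identity : ∀ x y u v → (x + u) - (y + v) ≡ 1ℤ * (x - y) + 1ℤ * (u - v)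
    identity = solve-∀

  +-congʳ : ∀ {x y} k → x ≈ y → x + k ≈ y + k
  +-congʳ k x≈y = +-cong x≈y (≈-refl {k})

  +-congˡ : ∀ k {x y} → x ≈ y → k + x ≈ k + y
  +-congˡ k = +-cong (≈-refl {k})

  *-congˡ : ∀ u {x y} → x ≈ y → u * x ≈ u * y
  *-congˡ u {x} {y} x≈y = ≈-by u x≈y (identity u x y)
    where
    identity : ∀ u x y → u * x - u * y ≡ u * (x - y)
    identity = solve-∀

  *-congʳ : ∀ x {u v} → u ≈ v → u * x ≈ v * x
  *-congʳ x {u} {v} u≈v = ≈-by x u≈v (identity x u v)
    where
    identity : ∀ x u v → u * x - v * x ≡ x * (u - v)
    identity = solve-∀

  neg-cong : ∀ {x y} → x ≈ y → - x ≈ - y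
  neg-cong {x} {y} x≈y = ≈-by -1ℤ x≈y (identity x y)
    where
    identity : ∀ x y → - x - - y ≡ -1ℤ * (x - y)
    identity = solve-∀

  ≈-flip : ∀ {x y t} → y ≈ x + - t → x ≈ y + t
  ≈-flip {x} {y} {t} y≈x-t = ≈-by -1ℤ y≈x-t (identity x y t)
    where
    identity : ∀ x y t → x - (y + t) ≡ -1ℤ * (y - (x + - t))
    identity = solve-∀

  +-cancelˡ : ∀ x {k l} → x + k ≈ x + l → k ≈ l
  +-cancelˡ x {k} {l} x+k≈x+l = ≈-by 1ℤ x+k≈x+l (identity x k l)
    where
    identity : ∀ x k l → k - l ≡ 1ℤ * ((x + k) - (x + l))
    identity = solve-∀

  n≈0 : + n ≈ 0ℤ
  n≈0 = mk≈ (divides 1ℤ (trans (ℤ.+-identityʳ (+ n)) (sym (ℤ.*-identityˡ (+ n)))))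

  +-multiple-≈ : ∀ x k → x + k * + n ≈ x
  +-multiple-≈ x k = ≈-by k n≈0 (identity x k (+ n))
    where
    identity : ∀ x k n → (x + k * n) - x ≡ k * (n - 0ℤ)
    identity = solve-∀

  ℕ-multiple-≈ : ∀ {x y} k → x ≡ y ℕ.+ k ℕ.* n → + x ≈ + y
  ℕ-multiple-≈ {x} {y} k refl = subst (_≈ + y) (sym pos-eq) (+-multiple-≈ (+ y) (+ k))
    where
    pos-eq : + (y ℕ.+ k ℕ.* n) ≡ + y + + k * + n
    pos-eq = trans (ℤ.pos-+ y (k ℕ.* n)) (cong (λ t → + y + t) (ℤ.pos-* k n))

  mod⇒≈ : ∀ {x y} → x ≡ y [mod n ] → + x ≈ + y
  mod⇒≈ x≡y = mk≈ (∣ᵤ⇒∣ x≡y)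

  ≈⇒mod : ∀ {x y} → + x ≈ + y → x ≡ y [mod n ]
  ≈⇒mod x≈y = ∣⇒∣ᵤ (divides-difference x≈y)

  residue-unique-≤ : ∀ {p q} → q ℕ.≤ p → p ℕ.< n → q ℕ.< n → + p ≈ + q → p ≡ q
  residue-unique-≤ {p} {q} q≤p p<n q<n p≈q = begin
    p                     ≡⟨ m<n⇒m%n≡m p<n ⟨
    p % n                 ≡⟨ cong (_% n) p≡q+kn ⟩
    (q ℕ.+ k ℕ.* n) % n   ≡⟨ [m+kn]%n≡m%n q k n ⟩
    q % n                 ≡⟨ m<n⇒m%n≡m q<n ⟩
    q                     ∎
    where
    open ≡-Reasoning
    n∣p∸q : n ∣ p ℕ.∸ q
    n∣p∸q = subst (n ∣_) (cong ℤ.∣_∣ (trans (ℤ.m-n≡m⊖n p q) (ℤ.⊖-≥ q≤p)))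
              (∣⇒∣ᵤ (divides-difference p≈q))
    k : ℕ
    k = ℕ.quotient n∣p∸q
    p≡q+kn : p ≡ q ℕ.+ k ℕ.* n
    p≡q+kn = trans (sym (ℕ.m+[n∸m]≡n q≤p)) (cong (q ℕ.+_) (ℕ.m∣n⇒n≡quotient*m n∣p∸q))

  residue-unique : ∀ {p q} → p ℕ.< n → q ℕ.< n → + p ≈ + q → p ≡ q
  residue-unique {p} {q} p<n q<n p≈q with ℕ.≤-total q p
  ... | inj₁ q≤p = residue-unique-≤ q≤p p<n q<n p≈q
  ... | inj₂ p≤q = sym (residue-unique-≤ p≤q q<n p<n (≈-sym p≈q))

  _≈±_ : ℤ → ℤ → Set
  s ≈± t = s ≈ t ⊎ s ≈ - t

  ≈±-respˡ : ∀ {s s′ t} → s ≈ s′ → s ≈± t → s′ ≈± t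
  ≈±-respˡ s≈s′ = [ inj₁ ∘ ≈-trans (≈-sym s≈s′) , inj₂ ∘ ≈-trans (≈-sym s≈s′) ]′

  ≈±-step : ∀ {x y s t} → y ≈ x + s → s ≈± t → y ≈ x + t ⊎ x ≈ y + t
  ≈±-step {x} y≈x+s (inj₁ s≈t)  = inj₁ (≈-trans y≈x+s (+-congˡ x s≈t))
  ≈±-step {x} y≈x+s (inj₂ s≈-t) = inj₂ (≈-flip (≈-trans y≈x+s (+-congˡ x s≈-t)))

  -- Opaque so that Agda can recover i from toℤ i when solving implicit arguments.
  opaque
    toℤ : Fin n → ℤ
    toℤ i = + toℕ i

  reduce : ℤ → Fin n
  reduce x = fromℕ< (n%ℕd<d x n)

  opaque
    unfolding toℤ

    shifted⇒≈ : ∀ {i j : Fin n} t → toℕ j ≡ toℕ i ℕ.+ t [mod n ] → toℤ j ≈ toℤ i + + t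
    shifted⇒≈ t = mod⇒≈

    ≈⇒shifted : ∀ {i j : Fin n} t → toℤ j ≈ toℤ i + + t → toℕ j ≡ toℕ i ℕ.+ t [mod n ]
    ≈⇒shifted t = ≈⇒mod

    toℤ-injective : ∀ {i j} → toℤ i ≈ toℤ j → i ≡ j
    toℤ-injective {i} {j} i≈j = Fin.toℕ-injective (residue-unique (Fin.toℕ<n i) (Fin.toℕ<n j) i≈j)

    mod⇒≡ : ∀ {i j : Fin n} → toℕ j ≡ toℕ i [mod n ] → j ≡ i
    mod⇒≡ = toℤ-injective ∘ mod⇒≈

    toℤ-reduce : ∀ x → toℤ (reduce x) ≈ x
    toℤ-reduce x = subst₂ _≈_ (cong +_ (sym (Fin.toℕ-fromℕ< (n%ℕd<d x n))))
                     (sym (a≡a%ℕn+[a/ℕn]*n x n)) (≈-sym (+-multiple-≈ (+ (x %ℕ n)) (x /ℕ n)))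

  reduce-cong : ∀ {x y} → x ≈ y → reduce x ≡ reduce y
  reduce-cong {x} {y} x≈y =
    toℤ-injective (≈-trans (toℤ-reduce x) (≈-trans x≈y (≈-sym (toℤ-reduce y))))

  reduce-injective : ∀ {x y} → reduce x ≡ reduce y → x ≈ y
  reduce-injective {x} {y} eq =
    ≈-trans (≈-sym (toℤ-reduce x)) (subst (λ i → toℤ i ≈ y) (sym eq) (toℤ-reduce y))

  reduce-toℤ : ∀ i → reduce (toℤ i) ≡ i
  reduce-toℤ i = toℤ-injective (toℤ-reduce (toℤ i))

  affine : ℤ → ℤ → Fin n → Fin n
  affine u k i = reduce (u * toℤ i + k)

  affine-step : ∀ u k {i j t} → toℤ j ≈ toℤ i + t →
                toℤ (affine u k j) ≈ toℤ (affine u k i) + u * t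
  affine-step u k {i} {j} {t} j≈i+t = begin
    toℤ (affine u k j)           ≈⟨ toℤ-reduce _ ⟩
    u * toℤ j + k                ≈⟨ +-congʳ k (*-congˡ u j≈i+t) ⟩
    u * (toℤ i + t) + k          ≡⟨ identity u (toℤ i) t k ⟩
    (u * toℤ i + k) + u * t      ≈⟨ +-congʳ (u * t) (toℤ-reduce (u * toℤ i + k)) ⟨
    toℤ (affine u k i) + u * t   ∎
    where
    open ≈-Reasoning
    identity : ∀ u x t k → u * (x + t) + k ≡ (u * x + k) + u * t
    identity = solve-∀

  affine-∘ : ∀ u v {w} k l i → u * v ≈ w → affine u l (affine v k i) ≡ affine w (u * k + l) i
  affine-∘ u v {w} k l i uv≈w = reduce-cong (begin
    u * toℤ (affine v k i) + l   ≈⟨ +-congʳ l (*-congˡ u (toℤ-reduce (v * toℤ i + k))) ⟩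
    u * (v * toℤ i + k) + l      ≡⟨ identity u v (toℤ i) k l ⟩
    (u * v) * toℤ i + (u * k + l) ≈⟨ +-congʳ (u * k + l) (*-congʳ (toℤ i) uv≈w) ⟩
    w * toℤ i + (u * k + l)      ∎)
    where
    open ≈-Reasoning
    identity : ∀ u v x k l → u * (v * x + k) + l ≡ (u * v) * x + (u * k + l)
    identity = solve-∀

  affine-cong : ∀ u {k l} i → k ≈ l → affine u k i ≡ affine u l i
  affine-cong u i k≈l = reduce-cong (+-congˡ (u * toℤ i) k≈l)

  affine-identity : ∀ {k} i → k ≈ 0ℤ → affine 1ℤ k i ≡ i
  affine-identity {k} i k≈0 = trans (reduce-cong i+k≈i) (reduce-toℤ i)
    where
    i+k≈i : 1ℤ * toℤ i + k ≈ toℤ i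
    i+k≈i = ≈-trans (+-congˡ (1ℤ * toℤ i) k≈0)
              (≈-reflexive (trans (ℤ.+-identityʳ _) (ℤ.*-identityˡ (toℤ i))))

  affine-hits : ∀ u i j → affine u (toℤ j - u * toℤ i) i ≡ j
  affine-hits u i j = trans (reduce-cong (≈-reflexive (identity (u * toℤ i) (toℤ j)))) (reduce-toℤ j)
    where
    identity : ∀ x y → x + (y - x) ≡ y
    identity = solve-∀

  affine-offset-injective : ∀ u {k l} i → affine u k i ≡ affine u l i → k ≈ l
  affine-offset-injective u i eq = +-cancelˡ (u * toℤ i) (reduce-injective eq)

module RoseWindow (n a r : ℕ) .{{_ : NonZero n}} where
  open import Data.Integer using (_+_; _*_)
  open Congruence n

  V : Set
  V = Vertex n

  Adjᴿ : V → V → Set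
  Adjᴿ = Adj n a r

  rim′ : ∀ {i j} → toℤ j ≈ toℤ i + + 1 → Edge n a r (A i) (A j)
  rim′ = rim _ _ ∘ ≈⇒shifted 1

  spoke′ : ∀ {i j} → j ≡ i → Edge n a r (A j) (B i)
  spoke′ {i} refl = spoke i i (≈⇒mod (≈-refl {+ toℕ i}))

  hub′ : ∀ {i j} → toℤ j ≈ toℤ i + + a → Edge n a r (A j) (B i)
  hub′ = hub _ _ ∘ ≈⇒shifted a

  inner′ : ∀ {i j} → toℤ j ≈ toℤ i + + r → Edge n a r (B i) (B j)
  inner′ = inner _ _ ∘ ≈⇒shifted r

  rim-either : ∀ {i j} → toℤ j ≈ toℤ i + + 1 ⊎ toℤ i ≈ toℤ j + + 1 → Adjᴿ (A i) (A j)
  rim-either = [ inj₁ ∘ rim′ , inj₂ ∘ rim′ ]′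

  inner-either : ∀ {i j} → toℤ j ≈ toℤ i + + r ⊎ toℤ i ≈ toℤ j + + r → Adjᴿ (B i) (B j)
  inner-either = [ inj₁ ∘ inner′ , inj₂ ∘ inner′ ]′

  index : V → Fin n
  index (A i) = i
  index (B i) = i

  module _ (c : ℤ) (c²≈1 : c * c ≈ 1ℤ) (ca≈-a : c * + a ≈ - + a) (c≈±r : c ≈± + r) where

    data Motion : Set where
      rotate swap : ℤ → Motion

    multiplier : Motion → ℤ
    multiplier (rotate _) = 1ℤ
    multiplier (swap _)   = c

    offset : Motion → ℤ
    offset (rotate k) = k
    offset (swap k)   = k

    act : Motion → V → V
    act (rotate k) (A i) = A (affine 1ℤ k i)
    act (rotate k) (B i) = B (affine 1ℤ k i)
    act (swap k)   (A i) = B (affine c k i)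
    act (swap k)   (B i) = A (affine c k i)

    infixr 9 _∘ᴹ_
    _∘ᴹ_ : Motion → Motion → Motion
    rotate l ∘ᴹ rotate k = rotate (1ℤ * k + l)
    rotate l ∘ᴹ swap k   = swap (1ℤ * k + l)
    swap l   ∘ᴹ rotate k = swap (c * k + l)
    swap l   ∘ᴹ swap k   = rotate (c * k + l)

    inverse : Motion → Motion
    inverse (rotate k) = rotate (- (1ℤ * k))
    inverse (swap k)   = swap (- (c * k))

    multiplier-∘ : ∀ g h → multiplier g * multiplier h ≈ multiplier (g ∘ᴹ h)
    multiplier-∘ (rotate _) (rotate _) = ≈-refl
    multiplier-∘ (rotate _) (swap _)   = ≈-reflexive (ℤ.*-identityˡ c)
    multiplier-∘ (swap _)   (rotate _) = ≈-reflexive (ℤ.*-identityʳ c)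
    multiplier-∘ (swap _)   (swap _)   = c²≈1

    affine-∘ᴹ : ∀ g h k l i → affine (multiplier g) l (affine (multiplier h) k i)
                            ≡ affine (multiplier (g ∘ᴹ h)) (multiplier g * k + l) i
    affine-∘ᴹ g h k l i = affine-∘ (multiplier g) (multiplier h) k l i (multiplier-∘ g h)

    act-∘ : ∀ g h x → act g (act h x) ≡ act (g ∘ᴹ h) x
    act-∘ g@(rotate l) h@(rotate k) (A i) = cong A (affine-∘ᴹ g h k l i)
    act-∘ g@(rotate l) h@(rotate k) (B i) = cong B (affine-∘ᴹ g h k l i)
    act-∘ g@(rotate l) h@(swap k)   (A i) = cong B (affine-∘ᴹ g h k l i)
    act-∘ g@(rotate l) h@(swap k)   (B i) = cong A (affine-∘ᴹ g h k l i)
    act-∘ g@(swap l)   h@(rotate k) (A i) = cong B (affine-∘ᴹ g h k l i)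
    act-∘ g@(swap l)   h@(rotate k) (B i) = cong A (affine-∘ᴹ g h k l i)
    act-∘ g@(swap l)   h@(swap k)   (A i) = cong A (affine-∘ᴹ g h k l i)
    act-∘ g@(swap l)   h@(swap k)   (B i) = cong B (affine-∘ᴹ g h k l i)


    act-identity : ∀ {k} → k ≈ 0ℤ → ∀ x → act (rotate k) x ≡ x
    act-identity k≈0 (A i) = cong A (affine-identity i k≈0)
    act-identity k≈0 (B i) = cong B (affine-identity i k≈0)

    inverse-∘ : ∀ g x → act (inverse g) (act g x) ≡ x
    inverse-∘ g@(rotate k) x =
      trans (act-∘ (inverse g) g x) (act-identity (≈-reflexive (ℤ.+-inverseʳ (1ℤ * k))) x)
    inverse-∘ g@(swap k)   x =
      trans (act-∘ (inverse g) g x) (act-identity (≈-reflexive (ℤ.+-inverseʳ (c * k))) x)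

    multiplier² : ∀ g → multiplier g * multiplier g ≈ 1ℤ
    multiplier² (rotate _) = ≈-refl
    multiplier² (swap _)   = c²≈1

    ∘-inverse-offset : ∀ g → multiplier g * - (multiplier g * offset g) + offset g ≈ 0ℤ
    ∘-inverse-offset g = ≈-by (- offset g) (multiplier² g) (identity (multiplier g) (offset g))
      where
      identity : ∀ m k → (m * - (m * k) + k) - 0ℤ ≡ (- k) * (m * m - 1ℤ)
      identity = solve-∀

    ∘-inverse : ∀ g x → act g (act (inverse g) x) ≡ x
    ∘-inverse g@(rotate k) x = trans (act-∘ g (inverse g) x) (act-identity (∘-inverse-offset g) x)
    ∘-inverse g@(swap k)   x = trans (act-∘ g (inverse g) x) (act-identity (∘-inverse-offset g) x)

    c*1≈±r : c * 1ℤ ≈± + r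
    c*1≈±r = ≈±-respˡ (≈-reflexive (sym (ℤ.*-identityʳ c))) c≈±r

    c*r≈±1 : c * + r ≈± 1ℤ
    c*r≈±1 = [ (λ c≈r → inj₁ (≈-trans (*-congˡ c (≈-sym c≈r)) c²≈1))
             , (λ c≈-r → inj₂ (begin
      c * + r          ≡⟨ cong (c *_) (ℤ.neg-involutive (+ r)) ⟨
      c * - - + r      ≈⟨ *-congˡ c (neg-cong c≈-r) ⟨
      c * - c          ≡⟨ ℤ.neg-distribʳ-* c c ⟨
      - (c * c)        ≈⟨ neg-cong c²≈1 ⟩
      -1ℤ              ∎)) ]′ c≈±r
      where open ≈-Reasoning

    rotate-step : ∀ k {i j t} → toℤ j ≈ toℤ i + t →
                  toℤ (affine 1ℤ k j) ≈ toℤ (affine 1ℤ k i) + t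
    rotate-step k {i} {t = t} j≈i+t = ≈-trans (affine-step 1ℤ k j≈i+t)
      (+-congˡ (toℤ (affine 1ℤ k i)) (≈-reflexive (ℤ.*-identityˡ t)))

    act-Edge : ∀ g {u v} → Edge n a r u v → Adjᴿ (act g u) (act g v)
    act-Edge (rotate k) (rim i j h)   = inj₁ (rim′ (rotate-step k (shifted⇒≈ 1 h)))
    act-Edge (rotate k) (spoke i j h) = inj₁ (spoke′ (cong (affine 1ℤ k) (mod⇒≡ h)))
    act-Edge (rotate k) (hub i j h)   = inj₁ (hub′ (rotate-step k (shifted⇒≈ a h)))
    act-Edge (rotate k) (inner i j h) = inj₁ (inner′ (rotate-step k (shifted⇒≈ r h)))
    act-Edge (swap k)   (rim i j h)   =
      inner-either (≈±-step (affine-step c k (shifted⇒≈ 1 h)) c*1≈±r)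
    act-Edge (swap k)   (spoke i j h) = inj₂ (spoke′ (cong (affine c k) (sym (mod⇒≡ h))))
    act-Edge (swap k)   (hub i j h)   =
      inj₂ (hub′ (≈-flip (≈-trans (affine-step c k (shifted⇒≈ a h))
                                  (+-congˡ (toℤ (affine c k i)) ca≈-a))))
    act-Edge (swap k)   (inner i j h) =
      rim-either (≈±-step (affine-step c k (shifted⇒≈ r h)) c*r≈±1)

    act-Adj : ∀ g {u v} → Adjᴿ u v → Adjᴿ (act g u) (act g v)
    act-Adj g (inj₁ e) = act-Edge g e
    act-Adj g (inj₂ e) = [ inj₂ , inj₁ ]′ (act-Edge g e)

    automorphism : Motion → Automorphism V Adjᴿ
    automorphism g = record
      { to = act g ; from = act (inverse g)
      ; from-to = inverse-∘ g ; to-from = ∘-inverse g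
      ; preserve = λ u v → act-Adj g
                         , subst₂ Adjᴿ (inverse-∘ g u) (inverse-∘ g v) ∘ act-Adj (inverse g) }

    IsMotion : Automorphism V Adjᴿ → Set
    IsMotion σ = Σ Motion (λ g → to σ ≗ act g)

    motion-between : V → V → Motion
    motion-between (A i) (A j) = rotate (toℤ j - 1ℤ * toℤ i)
    motion-between (A i) (B j) = swap (toℤ j - c * toℤ i)
    motion-between (B i) (A j) = swap (toℤ j - c * toℤ i)
    motion-between (B i) (B j) = rotate (toℤ j - 1ℤ * toℤ i)

    act-motion-between : ∀ u v → act (motion-between u v) u ≡ v
    act-motion-between (A i) (A j) = cong A (affine-hits 1ℤ i j)
    act-motion-between (A i) (B j) = cong B (affine-hits c i j)
    act-motion-between (B i) (A j) = cong A (affine-hits c i j)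
    act-motion-between (B i) (B j) = cong B (affine-hits 1ℤ i j)

    rotate-cong : ∀ {k l} → k ≈ l → act (rotate k) ≗ act (rotate l)
    rotate-cong k≈l (A i) = cong A (affine-cong 1ℤ i k≈l)
    rotate-cong k≈l (B i) = cong B (affine-cong 1ℤ i k≈l)

    swap-cong : ∀ {k l} → k ≈ l → act (swap k) ≗ act (swap l)
    swap-cong k≈l (A i) = cong B (affine-cong c i k≈l)
    swap-cong k≈l (B i) = cong A (affine-cong c i k≈l)

    act-determined : ∀ g h u → act g u ≡ act h u → act g ≗ act h
    act-determined (rotate k) (rotate l) (A i) eq = rotate-cong (affine-offset-injective 1ℤ i (cong index eq))
    act-determined (rotate k) (rotate l) (B i) eq = rotate-cong (affine-offset-injective 1ℤ i (cong index eq))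
    act-determined (swap k)   (swap l)   (A i) eq = swap-cong (affine-offset-injective c i (cong index eq))
    act-determined (swap k)   (swap l)   (B i) eq = swap-cong (affine-offset-injective c i (cong index eq))
    act-determined (rotate k) (swap l)   (A i) ()
    act-determined (rotate k) (swap l)   (B i) ()
    act-determined (swap k)   (rotate l) (A i) ()
    act-determined (swap k)   (rotate l) (B i) ()

    motions-regular : RegularSubgroup V Adjᴿ IsMotion
    motions-regular = record
      { has-id      = automorphism (rotate 0ℤ) , (rotate 0ℤ , λ _ → refl) , act-identity ≈-refl
      ; has-comp    = λ { σ τ (g , σ≗g) (h , τ≗h) →
          automorphism (g ∘ᴹ h) , (g ∘ᴹ h , λ _ → refl) ,
          λ x → sym (trans (cong (to σ) (τ≗h x)) (trans (σ≗g (act h x)) (act-∘ g h x))) }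
      ; has-inv     = λ { σ (g , σ≗g) →
          automorphism (inverse g) , (inverse g , λ _ → refl) ,
          λ x → trans (cong (act (inverse g)) (σ≗g x)) (inverse-∘ g x) }
      ; transitive  = λ u v →
          automorphism (motion-between u v) , (motion-between u v , λ _ → refl) , act-motion-between u v
      ; semiregular = λ { σ τ (g , σ≗g) (h , τ≗h) u eq x →
          let g≡h-at-u = trans (sym (σ≗g u)) (trans eq (τ≗h u))
          in trans (σ≗g x) (trans (act-determined g h u g≡h-at-u x) (sym (τ≗h x))) }
      }

    cayley : RoseWindowCayley n a r
    cayley = IsMotion , motions-regular

rose-window-r≡1-cayley : ∀ n a .{{_ : NonZero n}} → RoseWindowCayley n a 1
rose-window-r≡1-cayley n a =
  RoseWindow.cayley n a 1 -1ℤ ≈-refl (≈-reflexive (ℤ.-1*i≡-i (+ a))) (inj₂ ≈-refl)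
  where open Congruence n

open import Data.Nat using (_*_; _+_; _∸_; _≤_)

rose-window-r≡m∸1-cayley : ∀ q a → RoseWindowCayley (2 * (2 + 2 * q)) (2 * a) (1 + 2 * q)
rose-window-r≡m∸1-cayley q a = RoseWindow.cayley n (2 * a) r (+ r) r²≈1 r*2a≈-2a (inj₁ ≈-refl)
  where
  n r : ℕ
  n = 2 * (2 + 2 * q)
  r = 1 + 2 * q
  open Congruence n

  r²≈1 : + r ℤ.* + r ≈ 1ℤ
  r²≈1 = subst (_≈ 1ℤ) (ℤ.pos-* r r) (ℕ-multiple-≈ q (identity q))
    where
    identity : ∀ q → (1 + 2 * q) * (1 + 2 * q) ≡ 1 + q * (2 * (2 + 2 * q))
    identity = ℕ-Solver.solve-∀

  r*2a≈-2a : + r ℤ.* + (2 * a) ≈ - + (2 * a)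
  r*2a≈-2a = ≈-by 1ℤ r*2a+2a≈0 (ℤ-identity (+ r) (+ (2 * a)))
    where
    ℕ-identity : ∀ q a → (1 + 2 * q) * (2 * a) + 2 * a ≡ 0 + a * (2 * (2 + 2 * q))
    ℕ-identity = ℕ-Solver.solve-∀
    ℤ-identity : ∀ x y → x ℤ.* y - - y ≡ 1ℤ ℤ.* ((x ℤ.* y ℤ.+ y) - 0ℤ)
    ℤ-identity = solve-∀
    r*2a+2a≈0 : + r ℤ.* + (2 * a) ℤ.+ + (2 * a) ≈ 0ℤ
    r*2a+2a≈0 = subst (_≈ 0ℤ)
      (trans (ℤ.pos-+ (r * (2 * a)) (2 * a)) (cong (ℤ._+ + (2 * a)) (ℤ.pos-* r (2 * a))))
      (ℕ-multiple-≈ a (ℕ-identity q a))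

m∸1-odd⇒m≡2+2q : ∀ m → (m ∸ 1) % 2 ≡ 1 → Σ ℕ (λ q → m ≡ 2 + 2 * q)
m∸1-odd⇒m≡2+2q (suc k) k%2≡1 = k / 2 , cong suc (begin
  k                 ≡⟨ m≡m%n+[m/n]*n k 2 ⟩
  k % 2 + k / 2 * 2 ≡⟨ cong₂ _+_ k%2≡1 (ℕ.*-comm (k / 2) 2) ⟩
  1 + 2 * (k / 2)   ∎)
  where open ≡-Reasoning

-- The hypotheses on b are not needed: in both cases c·2b ≡ −2b (mod 2m) holds for every b.
mainTheorem17 : (m b r : ℕ) → 2 ≤ m →
    (m ∣ (b * b ∸ 1) ⊎ m ∣ (b * b + 1)) →
    2 ≤ 2 * b → 2 * b ≤ m →
    (r ≡ 1 ⊎ r ≡ m ∸ 1) → r % 2 ≡ 1 →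
    RoseWindowCayley (2 * m) (2 * b) r
mainTheorem17 m b r (s≤s (s≤s _)) _ _ _ (inj₁ refl) _ = rose-window-r≡1-cayley (2 * m) (2 * b)
mainTheorem17 m b r _ _ _ _ (inj₂ refl) r-odd with m∸1-odd⇒m≡2+2q m r-odd
... | q , refl = rose-window-r≡m∸1-cayley q b
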